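{- Let $b\geq 6$ be an even integer and let $d$ be an odd integer with $3\leq d\leq b/2$. If $n$ and $t$ are positive integers such that $n+jd$ is $b$-anti-Niven for all $0\leq j\leq t-1$, then $t\leq \lceil 2b/d\rceil+2$.
   Context: For a positive integer $n$ with base-$b$ expansion $n=\sum_{j=0}^m a_jb^j$ ($0\leq a_j\leq b-1$), $s_b(n)=\sum_{j=0}^m a_j$. A positive integer $n$ is $b$-anti-Niven if $\gcd(n,s_b(n))=1$. -}

module Defs where

open import Data.Nat using (ℕ; zero; suc; _+_; _*_; _∸_; _<_; _≤_; s≤s; z≤n; NonZero)
open import Data.Nat.DivMod using (_/_; _%_; m/n<m)
open import Data.Nat.GCD using (gcd)
open import Data.Nat.Induction using (<-rec)
open import Relation.Binary.PropositionalEquality using (_≡_)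

digitSum₂₊ : (c : ℕ) → ℕ → ℕ
digitSum₂₊ c = <-rec (λ _ → ℕ) step
  where
  step : (n : ℕ) → ({m : ℕ} → m < n → ℕ) → ℕ
  step zero rec = 0
  step (suc n) rec =
    suc n % suc (suc c) + rec {suc n / suc (suc c)} (m/n<m (suc n) (suc (suc c)) (s≤s (s≤s z≤n)))

-- s_b(n) for a base b. Only meaningful for b ≥ 2 (the only case used);
-- for the degenerate bases 0, 1 we arbitrarily return n.
digitSum : (b : ℕ) → ℕ → ℕ
digitSum (suc (suc c)) n = digitSum₂₊ c n
digitSum _ n = n

AntiNiven : (b : ℕ) → ℕ → Set
AntiNiven b n = gcd n (digitSum b n) ≡ 1

ceilDiv : (m d : ℕ) → .{{NonZero d}} → ℕ
ceilDiv m d = (m + (d ∸ 1)) / d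

-- Keep, among n, n + d, n + 2d, …, every other term, starting at the first even
-- one: since d is odd this gives an arithmetic progression x₀ < x₁ < … of even
-- numbers with difference 2d ≤ b, and t > ⌈2b/d⌉ + 2 terms leave room for an
-- index N with N·2d ≥ 2b.  For an even anti-Niven x with b even, x mod b is
-- even and s_b(x) is odd, so s_b(⌊x/b⌋) is odd.  As the difference is at most
-- b, the quotients ⌊xᵢ/b⌋ increase by at most one per step, from Q = ⌊x₀/b⌋ to
-- at least Q + 2; so s_b(Q), s_b(Q+1), s_b(Q+2) are all odd.  But s_b(y+1) =
-- s_b(y) + 1 unless b ∣ y + 1, which cannot happen for both y = Q and y = Q + 1.
module Submission where

open import Defs
open import Data.Nat using (ℕ; _+_; _*_; _≤_; _<_; _/_; NonZero)
open import Data.Nat.Divisibility using (_∣_)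
open import Relation.Nullary using (¬_)
open import Data.Nat using (zero; suc; _∸_; _%_; s≤s; z≤n; _<′_; <′-base; <′-step; _≟_; _≤?_)
open import Function using (_∘′_)
open import Data.Nat.Properties
open import Data.Nat.DivMod
open import Data.Nat.Divisibility using (divides; ∣-trans; n∣m*n; ∣m∣n⇒∣m+n; ∣m+n∣m⇒∣n; ∣1⇒≡1)
open import Data.Nat.GCD using (gcd-greatest)
open import Data.Nat.Induction using (<′-wellFounded; <′-wellFounded′)
open import Data.Nat.Solver using (module +-*-Solver)
open +-*-Solver using (solve; _:+_; _:*_; con; _:=_)
open import Data.Product using (∃-syntax; _×_; _,_)
open import Data.Sum using (_⊎_; inj₁; inj₂)
open import Data.Empty using (⊥)
open import Relation.Nullary using (yes; no; contradiction)
open import Relation.Binary.PropositionalEquality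

[m+n]/o≤1+n/o : ∀ {m} n {o} .{{_ : NonZero o}} → m ≤ o → (m + n) / o ≤ suc (n / o)
[m+n]/o≤1+n/o {m} n {o} m≤o = begin
  (m + n) / o      ≤⟨ /-monoˡ-≤ o (+-monoˡ-≤ n m≤o) ⟩
  (o + n) / o      ≡⟨ +-distrib-/-∣ˡ n (divides 1 (sym (*-identityˡ o))) ⟩
  o / o + n / o    ≡⟨ cong (_+ n / o) (n/n≡1 o) ⟩
  suc (n / o)      ∎
  where open ≤-Reasoning

[kn+m]/n≡k+m/n : ∀ k m n .{{_ : NonZero n}} → (k * n + m) / n ≡ k + m / n
[kn+m]/n≡k+m/n k m n = trans (+-distrib-/-∣ˡ m (n∣m*n k)) (cong (_+ m / n) (m*n/n≡m k n))

m≤ceilDiv[m,d]*d : ∀ m d .{{_ : NonZero d}} → m ≤ ceilDiv m d * d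
m≤ceilDiv[m,d]*d m (suc d-1) = +-cancelʳ-≤ d-1 m (ceilDiv m (suc d-1) * suc d-1) (begin
  m + d-1                 ≡⟨ m≡m%n+[m/n]*n (m + d-1) (suc d-1) ⟩
  (m + d-1) % suc d-1 + q ≤⟨ +-monoˡ-≤ q (≤-pred (m%n<n (m + d-1) (suc d-1))) ⟩
  d-1 + q                 ≡⟨ +-comm d-1 q ⟩
  q + d-1                 ∎)
  where
  open ≤-Reasoning
  q : ℕ
  q = ceilDiv m (suc d-1) * suc d-1

ceilDiv[m,d]*d≤m+d∸1 : ∀ m d .{{_ : NonZero d}} → ceilDiv m d * d ≤ m + (d ∸ 1)
ceilDiv[m,d]*d≤m+d∸1 m d = m/n*n≤m (m + (d ∸ 1)) d

2∣m⊎2∣1+m : ∀ m → 2 ∣ m ⊎ 2 ∣ suc m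
2∣m⊎2∣1+m zero = inj₁ (divides 0 refl)
2∣m⊎2∣1+m (suc m) with 2∣m⊎2∣1+m m
... | inj₁ (divides q refl) = inj₂ (divides (suc q) refl)
... | inj₂ 2∣1+m = inj₁ 2∣1+m

2∤m⇒2∣1+m : ∀ {m} → ¬ 2 ∣ m → 2 ∣ suc m
2∤m⇒2∣1+m {m} 2∤m with 2∣m⊎2∣1+m m
... | inj₁ 2∣m   = contradiction 2∣m 2∤m
... | inj₂ 2∣1+m = 2∣1+m

2∣1+m⇒2∣1+n⇒2∣m+n : ∀ {m n} → 2 ∣ suc m → 2 ∣ suc n → 2 ∣ m + n
2∣1+m⇒2∣1+n⇒2∣m+n {m} {n} 2∣1+m 2∣1+n =
  ∣m+n∣m⇒∣n {m = 2} (subst (2 ∣_) (cong suc (+-suc m n)) (∣m∣n⇒∣m+n 2∣1+m 2∣1+n)) (divides 1 refl)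

2∣m+o*d : ∀ {d} → ¬ 2 ∣ d → ∀ m → ∃[ o ] o ≤ 1 × 2 ∣ m + o * d
2∣m+o*d {d} 2∤d m with 2∣m⊎2∣1+m m
... | inj₁ 2∣m   = 0 , z≤n , subst (2 ∣_) (sym (+-identityʳ m)) 2∣m
... | inj₂ 2∣1+m = 1 , ≤-refl ,
  subst (λ x → 2 ∣ m + x) (sym (*-identityˡ d)) (2∣1+m⇒2∣1+n⇒2∣m+n 2∣1+m (2∤m⇒2∣1+m 2∤d))

intermediate-value : (f : ℕ → ℕ) → (∀ i → f (suc i) ≤ suc (f i)) →
                     ∀ N {v} → f 0 ≤ v → v ≤ f N → ∃[ i ] i ≤ N × f i ≡ v
intermediate-value f step zero      f0≤v v≤f0 = 0 , z≤n , ≤-antisym f0≤v v≤f0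
intermediate-value f step (suc N) {v} f0≤v v≤fN+1 with v ≤? f N
... | yes v≤fN with intermediate-value f step N f0≤v v≤fN
...   | i , i≤N , fi≡v = i , m≤n⇒m≤1+n i≤N , fi≡v
intermediate-value f step (suc N) {v} f0≤v v≤fN+1 | no v≰fN =
  suc N , ≤-refl , ≤-antisym (≤-trans (step N) (≰⇒> v≰fN)) v≤fN+1

-- `<-rec` passes the recursive call an accessibility proof obtained through
-- `<⇒<′`; it reduces to the canonical one, after which digitSum₂₊ unfolds.
<′-wellFounded′≡<′-wellFounded : ∀ n {m} (m<′n : m <′ n) → <′-wellFounded′ n m<′n ≡ <′-wellFounded m
<′-wellFounded′≡<′-wellFounded (suc n) <′-base         = refl
<′-wellFounded′≡<′-wellFounded (suc n) (<′-step m<′n) = <′-wellFounded′≡<′-wellFounded n m<′n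

digitSum₂₊-unfold : ∀ c n → digitSum₂₊ c n ≡ n % (2 + c) + digitSum₂₊ c (n / (2 + c))
digitSum₂₊-unfold c zero = refl
digitSum₂₊-unfold c (suc n)
  rewrite <′-wellFounded′≡<′-wellFounded (suc n) (<⇒<′ (m/n<m (suc n) (2 + c) (s≤s (s≤s z≤n))))
  = refl

module _ (c : ℕ) where

  B : ℕ
  B = 2 + c

  digitSum-unfold : ∀ n → digitSum B n ≡ n % B + digitSum B (n / B)
  digitSum-unfold = digitSum₂₊-unfold c

  digitSum-digit+ : ∀ {r} q → r < B → digitSum B (r + q * B) ≡ r + digitSum B q
  digitSum-digit+ {r} q r<B = begin
    digitSum B (r + q * B)                          ≡⟨ digitSum-unfold (r + q * B) ⟩
    (r + q * B) % B + digitSum B ((r + q * B) / B)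
      ≡⟨ cong₂ (λ x y → x + digitSum B y) [r+qB]%B≡r [r+qB]/B≡q ⟩
    r + digitSum B q                                ∎
    where
    open ≡-Reasoning
    [r+qB]%B≡r : (r + q * B) % B ≡ r
    [r+qB]%B≡r = trans ([m+kn]%n≡m%n r q B) (m<n⇒m%n≡m r<B)
    [r+qB]/B≡q : (r + q * B) / B ≡ q
    [r+qB]/B≡q = begin
      (r + q * B) / B   ≡⟨ cong (_/ B) (+-comm r (q * B)) ⟩
      (q * B + r) / B   ≡⟨ [kn+m]/n≡k+m/n q r B ⟩
      q + r / B         ≡⟨ cong (q +_) (m<n⇒m/n≡0 r<B) ⟩
      q + 0             ≡⟨ +-identityʳ q ⟩
      q                 ∎

  digitSum-suc : ∀ y → suc y % B ≢ 0 → digitSum B (suc y) ≡ suc (digitSum B y)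
  digitSum-suc y B∤1+y with m≤n⇒m<n∨m≡n (m%n<n y B)
  ... | inj₁ 1+r<B = begin
    digitSum B (suc y)                   ≡⟨ cong (digitSum B ∘′ suc) y≡r+qB ⟩
    digitSum B (suc (y % B) + y / B * B) ≡⟨ digitSum-digit+ (y / B) 1+r<B ⟩
    suc (y % B + digitSum B (y / B))     ≡⟨ cong suc (digitSum-digit+ (y / B) (m%n<n y B)) ⟨
    suc (digitSum B (y % B + y / B * B)) ≡⟨ cong (suc ∘′ digitSum B) y≡r+qB ⟨
    suc (digitSum B y)                   ∎
    where
    open ≡-Reasoning
    y≡r+qB : y ≡ y % B + y / B * B
    y≡r+qB = m≡m%n+[m/n]*n y B
  ... | inj₂ 1+r≡B = contradiction B∣1+y B∤1+y
    where
    open ≡-Reasoning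
    B∣1+y : suc y % B ≡ 0
    B∣1+y = begin
      suc y % B                     ≡⟨ cong (λ x → suc x % B) (m≡m%n+[m/n]*n y B) ⟩
      (suc (y % B) + y / B * B) % B ≡⟨ cong (λ x → (x + y / B * B) % B) 1+r≡B ⟩
      (B + y / B * B) % B           ≡⟨ [m+kn]%n≡m%n B (y / B) B ⟩
      B % B                         ≡⟨ n%n≡0 B ⟩
      0                             ∎

  consecutive-digitSums-not-all-odd : ∀ q → ¬ 2 ∣ digitSum B q → ¬ 2 ∣ digitSum B (1 + q) →
                                      ¬ 2 ∣ digitSum B (2 + q) → ⊥
  consecutive-digitSums-not-all-odd q odd₀ odd₁ odd₂ with suc q % B ≟ 0
  ... | no  B∤1+q = odd₁ (subst (2 ∣_) (sym (digitSum-suc q B∤1+q)) (2∤m⇒2∣1+m odd₀))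
  ... | yes B∣1+q = odd₂ (subst (2 ∣_) (sym (digitSum-suc (suc q) B∤2+q)) (2∤m⇒2∣1+m odd₁))
    where
    B∤2+q : suc (suc q) % B ≢ 0
    B∤2+q B∣2+q with trans (sym B∣1+q) (%-pred-≡0 {suc q} {B} B∣2+q)
    ... | ()

  even-antiNiven⇒odd-digitSum-quotient : 2 ∣ B → ∀ {x} → 2 ∣ x → AntiNiven B x →
                                         ¬ 2 ∣ digitSum B (x / B)
  even-antiNiven⇒odd-digitSum-quotient 2∣B {x} 2∣x gcd≡1 2∣s[x/B]
    with ∣1⇒≡1 (subst (2 ∣_) gcd≡1 (gcd-greatest 2∣x 2∣s[x]))
    where
    2∣x%B : 2 ∣ x % B
    2∣x%B = ∣m+n∣m⇒∣n (subst (2 ∣_) (trans (m≡m%n+[m/n]*n x B) (+-comm (x % B) _)) 2∣x)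
                      (∣-trans 2∣B (n∣m*n (x / B)))
    2∣s[x] : 2 ∣ digitSum B x
    2∣s[x] = subst (2 ∣_) (sym (digitSum-unfold x)) (∣m∣n⇒∣m+n 2∣x%B 2∣s[x/B])
  ... | ()

  even-antiNiven-progression-bound : 2 ∣ B → ∀ {a e} N → 2 ∣ a → 2 ∣ e → e ≤ B → 2 * B ≤ N * e →
                                     ((i : ℕ) → i ≤ N → AntiNiven B (i * e + a)) → ⊥
  even-antiNiven-progression-bound 2∣B {a} {e} N 2∣a 2∣e e≤B 2B≤Ne antiNiven =
    consecutive-digitSums-not-all-odd (f 0) (odd-at 0 z≤n)
      (odd-between (n≤1+n (f 0)) (≤-trans (n≤1+n _) 2+f0≤fN))
      (odd-between (≤-trans (n≤1+n _) (n≤1+n _)) 2+f0≤fN)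
    where
    f : ℕ → ℕ
    f i = (i * e + a) / B
    odd-at : ∀ i → i ≤ N → ¬ 2 ∣ digitSum B (f i)
    odd-at i i≤N = even-antiNiven⇒odd-digitSum-quotient 2∣B
      (∣m∣n⇒∣m+n (∣-trans 2∣e (n∣m*n i)) 2∣a) (antiNiven i i≤N)
    step : ∀ i → f (suc i) ≤ suc (f i)
    step i = subst (λ x → x / B ≤ suc (f i)) (sym (+-assoc e (i * e) a))
                   ([m+n]/o≤1+n/o (i * e + a) e≤B)
    2+f0≤fN : 2 + f 0 ≤ f N
    2+f0≤fN = begin
      2 + f 0           ≡⟨ [kn+m]/n≡k+m/n 2 a B ⟨
      (2 * B + a) / B   ≤⟨ /-monoˡ-≤ B (+-monoˡ-≤ a 2B≤Ne) ⟩
      f N               ∎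
      where open ≤-Reasoning
    odd-between : ∀ {v} → f 0 ≤ v → v ≤ f N → ¬ 2 ∣ digitSum B v
    odd-between f0≤v v≤fN with intermediate-value f step N f0≤v v≤fN
    ... | i , i≤N , refl = odd-at i i≤N

theorem3p4 : (b d : ℕ) → 6 ≤ b → 2 ∣ b → ¬ (2 ∣ d) → 3 ≤ d → d ≤ b / 2 →
    (n t : ℕ) → 1 ≤ n → 1 ≤ t →
    ((j : ℕ) → j < t → AntiNiven b (n + j * d)) →
    .{{_ : NonZero d}} → t ≤ ceilDiv (2 * b) d + 2
theorem3p4 zero          _ () _ _ _ _ _ _ _ _ _
theorem3p4 (suc zero)    _ (s≤s ()) _ _ _ _ _ _ _ _ _
theorem3p4 b@(suc (suc c)) d _ 2∣b 2∤d _ d≤b/2 n t _ _ antiNiven with 2∣m+o*d 2∤d n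
... | o , o≤1 , 2∣n+od = ≮⇒≥ λ k+2<t →
  even-antiNiven-progression-bound c 2∣b N 2∣n+od (divides d (*-comm 2 d)) 2d≤b 2b≤N*2d
    λ i i≤N → subst (AntiNiven b) (reindex i)
                (antiNiven (o + 2 * i) (≤-<-trans (o+2i≤k+2 i i≤N) k+2<t))
  where
  k N : ℕ
  k = ceilDiv (2 * b) d
  N = ceilDiv k 2
  2d≤b : 2 * d ≤ b
  2d≤b = ≤-trans (*-monoʳ-≤ 2 d≤b/2) (≤-reflexive (m*[n/m]≡n 2∣b))
  2b≤N*2d : 2 * b ≤ N * (2 * d)
  2b≤N*2d = begin
    2 * b         ≤⟨ m≤ceilDiv[m,d]*d (2 * b) d ⟩
    k * d         ≤⟨ *-monoˡ-≤ d (m≤ceilDiv[m,d]*d k 2) ⟩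
    N * 2 * d     ≡⟨ *-assoc N 2 d ⟩
    N * (2 * d)   ∎
    where open ≤-Reasoning
  o+2i≤k+2 : ∀ i → i ≤ N → o + 2 * i ≤ k + 2
  o+2i≤k+2 i i≤N = begin
    o + 2 * i     ≤⟨ +-mono-≤ o≤1 (*-monoʳ-≤ 2 i≤N) ⟩
    1 + 2 * N     ≡⟨ cong (1 +_) (*-comm 2 N) ⟩
    1 + N * 2     ≤⟨ +-monoʳ-≤ 1 (ceilDiv[m,d]*d≤m+d∸1 k 2) ⟩
    1 + (k + 1)   ≡⟨ +-suc k 1 ⟨
    k + 2         ∎
    where open ≤-Reasoning
  reindex : ∀ i → n + (o + 2 * i) * d ≡ i * (2 * d) + (n + o * d)
  reindex i = solve 4
    (λ n o i d → n :+ (o :+ con 2 :* i) :* d := i :* (con 2 :* d) :+ (n :+ o :* d)) refl n o i d
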